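{- For every $i\geq 1$ and every $1\leq j\leq \lceil i/2\rceil$, $$h_{i,j}(q)=\sum_{p\in \mathcal{SAP}_{i,j}}q^{\mathrm{ch}(p)-j+1}.$$
   Context: The array $(h_{i,j}(q))_{i,j\geq 1}$ of polynomials in $q$ is defined by $h_{1,1}(q)=h_{2,1}(q)=1$, $h_{2i+1,1}(q)=0$ for $i\geq 1$, the convention $h_{i,j}(q)=0$ if $j<0$ or $j>\lceil i/2\rceil$, and for $i\geq 1$: $h_{2i+1,j}(q)=h_{2i+1,j-1}(q)+q^{j-2}h_{2i,j-1}(q)$ for $j=2,\ldots,i+1$, and $h_{2i,j}(q)=h_{2i,j+1}(q)+q^{j-1}h_{2i-1,j}(q)$ for $j=i,i-1,\ldots,1$. A strict-alternating pistol on $[m]=\{1,\ldots,m\}$ is a map $p:[m]\to[m]$ such that, for all $i$ for which the arguments lie in $[m]$: $p(2i)\leq i$, $p(2i-1)\leq i$, $p(2i-1)\geq p(2i)$ and $p(2i)<p(2i+1)$. The charge of $p$ is $\mathrm{ch}(p)=\sum_{k=1}^m (p(k)-1)$. $\mathcal{SAP}_{i,j}$ denotes the set of strict-alternating pistols $p$ on $[i]$ with $p(i)=j$. -}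

module Defs where

open import Data.Nat.Base using (ℕ; zero; suc; _+_; _∸_; _≤ᵇ_; _<ᵇ_; _≡ᵇ_; _/_; _%_; ⌈_/2⌉)
open import Data.Bool.Base using (Bool; true; false; if_then_else_; _∧_; not)
open import Data.List.Base using (List; []; _∷_; map; concatMap; applyUpTo; filter; foldr)
open import Data.Bool.ListAction using (and)
open import Data.Nat.ListAction using (sum)
open import Relation.Binary.PropositionalEquality using (_≡_)
open import Relation.Nullary.Decidable using (T?)

-- Polynomials in q with natural-number coefficients, represented by
-- their coefficient function: f k = coefficient of q^k.
-- Two polynomials are equal iff all coefficients agree.

Poly : Set
Poly = ℕ → ℕ

0P : Poly
0P _ = 0

mono : ℕ → Poly
mono e k = if k ≡ᵇ e then 1 else 0

1P : Poly
1P = mono 0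

_⊕_ : Poly → Poly → Poly
(f ⊕ g) k = f k + g k

q^_·_ : ℕ → Poly → Poly
(q^ e · f) k = if k <ᵇ e then 0 else f (k ∸ e)

ΣP : List Poly → Poly
ΣP = foldr _⊕_ 0P

-- Heven i j = h_{2i,j}   (i ≥ 1),   Hodd i j = h_{2i+1,j}   (i ≥ 0).
-- All values with j = 0 or j > ⌈n/2⌉ are 0 (convention).

-- Odd row 2i+1 (i ≥ 1) from even row E = h_{2i,·}, without the cutoff:
--   oddAux E 1 = h_{2i+1,1} = 0,
--   oddAux E (j+2) = oddAux E (j+1) + q^j · E (j+1)
--   i.e. h_{2i+1,j} = h_{2i+1,j-1} + q^{j-2} h_{2i,j-1}.
oddAux : (ℕ → Poly) → ℕ → Poly
oddAux E zero = 0P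
oddAux E (suc zero) = 0P
oddAux E (suc (suc j)) = oddAux E (suc j) ⊕ (q^ j · E (suc j))

-- Even row 2i from odd row O = h_{2i-1,·}, counting j downward:
-- evenAux O j d = h_{2i,j} where j + d = i + 1; base d = 0 is
-- h_{2i,i+1} = 0, and  h_{2i,j} = h_{2i,j+1} + q^{j-1} h_{2i-1,j}.
evenAux : (ℕ → Poly) → ℕ → ℕ → Poly
evenAux O j zero = 0P
evenAux O j (suc d) = evenAux O (suc j) d ⊕ (q^ (j ∸ 1) · O j)

inRange : ℕ → ℕ → Bool
inRange b j = (1 ≤ᵇ j) ∧ (j ≤ᵇ b)

mutual
  Hodd : ℕ → ℕ → Poly
  Hodd zero j = if j ≡ᵇ 1 then 1P else 0P
  Hodd (suc i) j =
    if inRange (suc (suc i)) j then oddAux (Heven (suc i)) j else 0P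

  Heven : ℕ → ℕ → Poly
  Heven zero j = 0P                                   -- unused (row 0)
  Heven (suc i) j =
    if inRange (suc i) j then evenAux (Hodd i) j (suc (suc i) ∸ j) else 0P

h : ℕ → ℕ → Poly
h n j = if n % 2 ≡ᵇ 0 then Heven (n / 2) j else Hodd (n / 2) j

-- Maps p : [m] → [m], represented as the list [p(1), …, p(m)].

maps : ℕ → ℕ → List (List ℕ)
maps zero m = [] ∷ []
maps (suc n) m = concatMap (λ v → map (v ∷_) (maps n m)) (applyUpTo suc m)

allMaps : ℕ → List (List ℕ)
allMaps m = maps m m

-- 1-indexed evaluation p(k) (only used for k ∈ [m])
at : List ℕ → ℕ → ℕ
at [] k = 0
at (x ∷ xs) zero = 0
at (x ∷ xs) (suc zero) = x
at (x ∷ xs) (suc (suc k)) = at xs (suc k)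

_⇒ᵇ_ : Bool → Bool → Bool
a ⇒ᵇ b = not a Data.Bool.Base.∨ b

-- strict-alternating condition on p : [m] → [m]; every i for which the
-- relevant arguments lie in [m] satisfies i ≤ m, so checking i = 1..m suffices.
isStrictAlt : ℕ → List ℕ → Bool
isStrictAlt m p = and (map cond (applyUpTo suc m))
  where
  cond : ℕ → Bool
  cond i =
    ((i + i ≤ᵇ m) ⇒ᵇ (at p (i + i) ≤ᵇ i)) ∧
    ((i + i ∸ 1 ≤ᵇ m) ⇒ᵇ (at p (i + i ∸ 1) ≤ᵇ i)) ∧
    ((i + i ≤ᵇ m) ⇒ᵇ (at p (i + i) ≤ᵇ at p (i + i ∸ 1))) ∧
    ((suc (i + i) ≤ᵇ m) ⇒ᵇ (at p (i + i) <ᵇ at p (suc (i + i))))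

ch : List ℕ → ℕ
ch p = sum (map (λ x → x ∸ 1) p)

isSAP : ℕ → ℕ → List ℕ → Bool
isSAP i j p = isStrictAlt i p ∧ (at p i ≡ᵇ j)

SAP : ℕ → ℕ → List (List ℕ)
SAP i j = filter (λ p → T? (isSAP i j p)) (allMaps i)

sapSum : ℕ → ℕ → Poly
sapSum i j = ΣP (map (λ p → mono (ch p + 1 ∸ j)) (SAP i j))

{-# OPTIONS --safe #-}
module Submission where

-- Deleting the last value j of a strict-alternating pistol on [n+1] leaves a
-- strict-alternating pistol on [n] whose last value j′ satisfies j′ < j when n + 1
-- is odd and j′ ≥ j when n + 1 is even (and j ≤ ⌈(n+1)/2⌉ in both cases).  Since
-- ch p - j + 1 = (j′ - 1) + (ch p′ - j′ + 1) for the shortened pistol p′, the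
-- generating functions S_{n,j} = Σ_{p ∈ SAP_{n,j}} q^{ch p - j + 1} obey (for n ≥ 1)
--   S_{n+1,j} = Σ_{j′ admissible before j} q^{j′-1} S_{n,j′},
-- and summing over j′ < j, resp. j′ ≥ j, gives exactly the two recurrences defining
-- h.  This rests on reading strict alternation position by position: p(k+1) ≤ ⌈(k+1)/2⌉,
-- together with p(k+1) ≤ p(k) when k+1 is even and p(k) < p(k+1) when k+1 ≥ 3 is odd.

open import Defs
open import Algebra.Properties.CommutativeSemigroup using (interchange)
open import Data.Bool.Base using (Bool; true; false; if_then_else_; _∧_; T)
open import Data.Bool.Properties using (T-∧; T-≡)
open import Data.Empty using (⊥; ⊥-elim)
open import Data.List.Base using (List; []; _∷_; [_]; _++_; _∷ʳ_; map; concatMap; applyUpTo; filter; length)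
open import Data.List.Properties using (map-++; map-cong; map-cong-local; map-∘; applyUpTo-∷ʳ)
open import Data.List.Relation.Unary.All as All using (All; []; _∷_)
open import Data.List.Relation.Unary.All.Properties using (all⁺; all⁻; applyUpTo⁺₁; applyUpTo⁻; concat⁺; map⁺)
open import Data.Nat.Base hiding (parity)
open import Data.Nat.Divisibility using (divides)
open import Data.Nat.DivMod using ([m+kn]%n≡m%n; +-distrib-/-∣ʳ; m*n/n≡m)
open import Data.Nat.ListAction using (sum)
open import Data.Nat.ListAction.Properties using (sum-++)
open import Data.Nat.Properties
open import Data.Product.Base using (_×_; _,_; proj₁; proj₂)
open import Data.Product.Function.NonDependent.Propositional using (_×-⇔_)
open import Data.Sum.Base using (_⊎_; inj₁; inj₂; [_,_]′)
open import Data.Unit.Base using (tt)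
open import Function.Base using (_∘_)
open import Function.Bundles using (_⇔_; mk⇔; Equivalence)
open import Function.Construct.Identity using (⇔-id)
open import Function.Properties.Equivalence using () renaming (trans to ⇔-trans; sym to ⇔-sym)
open import Relation.Binary.PropositionalEquality
  using (_≡_; _≢_; refl; sym; trans; cong; cong₂; cong-app; subst; module ≡-Reasoning)
open import Relation.Nullary using (yes; no)
open import Relation.Nullary.Decidable using (T?)

private variable
  A B : Set

-- Finite sums

∑ : List A → (A → ℕ) → ℕ
∑ xs f = sum (map f xs)

syntax ∑ xs (λ x → e) = ∑[ x ∈ xs ] e

∑-++ : ∀ (xs ys : List A) f → ∑ (xs ++ ys) f ≡ ∑ xs f + ∑ ys f
∑-++ xs ys f = trans (cong sum (map-++ f xs ys)) (sum-++ (map f xs) (map f ys))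

∑-concatMap : ∀ (g : A → List B) xs f → ∑ (concatMap g xs) f ≡ ∑[ x ∈ xs ] ∑ (g x) f
∑-concatMap g []       f = refl
∑-concatMap g (x ∷ xs) f =
  trans (∑-++ (g x) (concatMap g xs) f) (cong (∑ (g x) f +_) (∑-concatMap g xs f))

∑-map : ∀ (g : A → B) xs f → ∑ (map g xs) f ≡ ∑[ x ∈ xs ] f (g x)
∑-map g xs f = cong sum (sym (map-∘ xs))

∑-cong : ∀ {xs : List A} {f g} → All (λ x → f x ≡ g x) xs → ∑ xs f ≡ ∑ xs g
∑-cong = cong sum ∘ map-cong-local

∑-cong-∀ : ∀ (xs : List A) {f g} → (∀ x → f x ≡ g x) → ∑ xs f ≡ ∑ xs g
∑-cong-∀ xs f≗g = cong sum (map-cong f≗g xs)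

∑-zero : ∀ {xs : List A} {f} → All (λ x → f x ≡ 0) xs → ∑ xs f ≡ 0
∑-zero []           = refl
∑-zero (fx≡0 ∷ all) = cong₂ _+_ fx≡0 (∑-zero all)

∑-+ : ∀ (xs : List A) f g → ∑[ x ∈ xs ] (f x + g x) ≡ ∑ xs f + ∑ xs g
∑-+ []       f g = refl
∑-+ (x ∷ xs) f g = trans (cong (f x + g x +_) (∑-+ xs f g))
                         (interchange +-commutativeSemigroup (f x) (g x) (∑ xs f) (∑ xs g))

∑-swap : ∀ (xs : List A) (ys : List B) (f : A → B → ℕ) →
         ∑[ x ∈ xs ] ∑[ y ∈ ys ] f x y ≡ ∑[ y ∈ ys ] ∑[ x ∈ xs ] f x y
∑-swap []       ys f = sym (∑-zero (All.universal (λ _ → refl) ys))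
∑-swap (x ∷ xs) ys f =
  trans (cong (∑ ys (f x) +_) (∑-swap xs ys f)) (sym (∑-+ ys (f x) _))

when : Bool → ℕ → ℕ
when b x = if b then x else 0

when-true : ∀ {b} x → T b → when b x ≡ x
when-true {true} x _ = refl

when-zero : ∀ b {x} → (T b → x ≡ 0) → when b x ≡ 0
when-zero false x≡0 = refl
when-zero true  x≡0 = x≡0 _

when-∧ : ∀ a b x → when (a ∧ b) x ≡ when b (when a x)
when-∧ true  b     x = refl
when-∧ false true  x = refl
when-∧ false false x = refl

∑-when : ∀ b (xs : List A) f → when b (∑ xs f) ≡ ∑[ x ∈ xs ] when b (f x)
∑-when true  xs f = refl
∑-when false xs f = sym (∑-zero (All.universal (λ _ → refl) xs))

when-<ᵇ-suc : ∀ v j x → when (v <ᵇ suc j) x ≡ when (v <ᵇ j) x + when (v ≡ᵇ j) x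
when-<ᵇ-suc zero    zero    x = refl
when-<ᵇ-suc zero    (suc j) x = sym (+-identityʳ x)
when-<ᵇ-suc (suc v) zero    x = refl
when-<ᵇ-suc (suc v) (suc j) x = when-<ᵇ-suc v j x

when-≤ᵇ-suc : ∀ j v x → when (j ≤ᵇ v) x ≡ when (suc j ≤ᵇ v) x + when (v ≡ᵇ j) x
when-≤ᵇ-suc zero    zero    x = refl
when-≤ᵇ-suc zero    (suc v) x = sym (+-identityʳ x)
when-≤ᵇ-suc (suc j) zero    x = refl
when-≤ᵇ-suc (suc j) (suc v) x = trans (cong (λ b → when b x) (<ᵇ-suc j v)) (when-≤ᵇ-suc j v x)
  where
  <ᵇ-suc : ∀ j v → (j <ᵇ suc v) ≡ (j ≤ᵇ v)
  <ᵇ-suc zero    v = refl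
  <ᵇ-suc (suc j) v = refl

≡ᵇ-sym : ∀ m n → (m ≡ᵇ n) ≡ (n ≡ᵇ m)
≡ᵇ-sym zero    zero    = refl
≡ᵇ-sym zero    (suc n) = refl
≡ᵇ-sym (suc m) zero    = refl
≡ᵇ-sym (suc m) (suc n) = ≡ᵇ-sym m n

range : ℕ → List ℕ
range m = applyUpTo suc m

All-range : ∀ m {P : ℕ → Set} → (∀ {v} → 1 ≤ v → v ≤ m → P v) → All P (range m)
All-range m P = applyUpTo⁺₁ suc m (P (s≤s z≤n))

∑-select : ∀ m (f : ℕ → ℕ) {c} → 1 ≤ c → c ≤ m → ∑[ v ∈ range m ] when (v ≡ᵇ c) (f v) ≡ f c
∑-select zero    f (s≤s z≤n) ()
∑-select (suc m) f {c} 1≤c c≤1+m = begin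
  ∑[ v ∈ range (suc m) ] F v              ≡⟨ cong (λ vs → ∑ vs F) (sym (applyUpTo-∷ʳ suc m)) ⟩
  ∑[ v ∈ range m ∷ʳ suc m ] F v           ≡⟨ ∑-++ (range m) _ F ⟩
  ∑[ v ∈ range m ] F v + (F (suc m) + 0)  ≡⟨ cong (∑ (range m) F +_) (+-identityʳ _) ⟩
  ∑[ v ∈ range m ] F v + F (suc m)        ≡⟨ last-or-earlier (m≤n⇒m<n∨m≡n c≤1+m) ⟩
  f c                                     ∎
  where
  open ≡-Reasoning
  F : ℕ → ℕ
  F v = when (v ≡ᵇ c) (f v)
  miss : ∀ {v} → v ≢ c → F v ≡ 0
  miss v≢c = when-zero _ (λ t → ⊥-elim (v≢c (≡ᵇ⇒≡ _ _ t)))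
  last-or-earlier : c < suc m ⊎ c ≡ suc m → ∑ (range m) F + F (suc m) ≡ f c
  last-or-earlier (inj₁ c≤m) =
    trans (cong₂ _+_ (∑-select m f 1≤c (≤-pred c≤m)) (miss (λ 1+m≡c → <-irrefl (sym 1+m≡c) c≤m)))
          (+-identityʳ _)
  last-or-earlier (inj₂ refl) =
    cong₂ _+_ (∑-zero (All-range m (λ _ v≤m → miss (λ v≡c → <⇒≱ (s≤s v≤m) (≤-reflexive (sym v≡c))))))
              (when-true _ (≡⇒≡ᵇ c c refl))

q^·-cong : ∀ e {f g : Poly} → (∀ k → f k ≡ g k) → ∀ k → (q^ e · f) k ≡ (q^ e · g) k
q^·-cong e f≗g k with k <ᵇ e
... | true  = refl
... | false = f≗g (k ∸ e)

q^·-zero : ∀ e {f : Poly} → (∀ k → f k ≡ 0) → ∀ k → (q^ e · f) k ≡ 0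
q^·-zero e f≗0 k with k <ᵇ e
... | true  = refl
... | false = f≗0 (k ∸ e)

q^·-∑ : ∀ e (xs : List A) (F : A → Poly) k →
        (q^ e · (λ k → ∑[ x ∈ xs ] F x k)) k ≡ ∑[ x ∈ xs ] (q^ e · F x) k
q^·-∑ e xs F k with k <ᵇ e
... | true  = sym (∑-zero (All.universal (λ _ → refl) xs))
... | false = refl

q^·-mono : ∀ {e c} → e ≤ c → ∀ k → mono c k ≡ (q^ e · mono (c ∸ e)) k
q^·-mono {zero}          _         k       = refl
q^·-mono {suc e} {suc c} (s≤s e≤c) zero    = refl
q^·-mono {suc e} {suc c} (s≤s e≤c) (suc k) = q^·-mono e≤c k

-- Pistols as lists

at-∷ʳ : ∀ xs v {k} → k ≤ length xs → at (xs ∷ʳ v) k ≡ at xs k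
at-∷ʳ []       v {zero}        _         = refl
at-∷ʳ (x ∷ xs) v {zero}        _         = refl
at-∷ʳ (x ∷ xs) v {suc zero}    _         = refl
at-∷ʳ (x ∷ xs) v {suc (suc k)} (s≤s k≤n) = at-∷ʳ xs v k≤n

at-∷ʳ-last : ∀ xs v → at (xs ∷ʳ v) (suc (length xs)) ≡ v
at-∷ʳ-last []       v = refl
at-∷ʳ-last (x ∷ xs) v = at-∷ʳ-last xs v

at-All : ∀ {P : ℕ → Set} {xs k} → All P xs → 1 ≤ k → k ≤ length xs → P (at xs k)
at-All {k = suc zero}    (px ∷ _)   _ _         = px
at-All {k = suc (suc k)} (_  ∷ pxs) _ (s≤s k≤n) = at-All pxs (s≤s z≤n) k≤n

ch-∷ʳ : ∀ xs v → ch (xs ∷ʳ v) ≡ ch xs + (v ∸ 1)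
ch-∷ʳ xs v = begin
  sum (map (_∸ 1) (xs ++ v ∷ []))  ≡⟨ cong sum (map-++ (_∸ 1) xs (v ∷ [])) ⟩
  sum (map (_∸ 1) xs ++ [ v ∸ 1 ]) ≡⟨ sum-++ (map (_∸ 1) xs) _ ⟩
  ch xs + (v ∸ 1 + 0)               ≡⟨ cong (ch xs +_) (+-identityʳ _) ⟩
  ch xs + (v ∸ 1)                   ∎
  where open ≡-Reasoning

at∸1≤ch : ∀ p k → at p k ∸ 1 ≤ ch p
at∸1≤ch []       k             = z≤n
at∸1≤ch (x ∷ xs) zero          = z≤n
at∸1≤ch (x ∷ xs) (suc zero)    = m≤m+n (x ∸ 1) (ch xs)
at∸1≤ch (x ∷ xs) (suc (suc k)) = ≤-trans (at∸1≤ch xs (suc k)) (m≤n+m (ch xs) (x ∸ 1))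

InRange : ℕ → ℕ → Set
InRange m v = 1 ≤ v × v ≤ m

All-maps : ∀ n m {P : List ℕ → Set} →
           (∀ {xs} → length xs ≡ n → All (InRange m) xs → P xs) → All P (maps n m)
All-maps zero    m P = P refl [] ∷ []
All-maps (suc n) m P = concat⁺ (map⁺ (All-range m (λ 1≤v v≤m →
  map⁺ (All-maps n m (λ len vs → P (cong suc len) ((1≤v , v≤m) ∷ vs))))))

∑-maps-suc : ∀ n m F → ∑ (maps (suc n) m) F ≡ ∑[ v ∈ range m ] ∑[ xs ∈ maps n m ] F (v ∷ xs)
∑-maps-suc n m F =
  trans (∑-concatMap _ (range m) F) (∑-cong-∀ (range m) (λ v → ∑-map (v ∷_) (maps n m) F))

∑-maps-∷ʳ : ∀ n m F → ∑ (maps (suc n) m) F ≡ ∑[ xs ∈ maps n m ] ∑[ v ∈ range m ] F (xs ∷ʳ v)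
∑-maps-∷ʳ zero m F =
  trans (∑-maps-suc zero m F)
        (trans (∑-cong-∀ (range m) (λ v → +-identityʳ (F [ v ]))) (sym (+-identityʳ _)))
∑-maps-∷ʳ (suc n) m F =
  trans (∑-maps-suc (suc n) m F)
        (trans (∑-cong-∀ (range m) (λ v → ∑-maps-∷ʳ n m (F ∘ (v ∷_))))
               (sym (∑-maps-suc n m _)))

-- Strict alternation, position by position

data Parity : ℕ → Set where
  zero : Parity 0
  odd  : ∀ r → Parity (suc (r + r))
  even : ∀ r → Parity (suc (suc (r + r)))

parity : ∀ n → Parity n
parity zero = zero
parity (suc n) with parity n
... | zero   = odd 0
... | odd r  = even r
... | even r = subst Parity (cong (suc ∘ suc) (+-suc r r)) (odd (suc r))

T-injective : ∀ {a b} → T a ⇔ T b → a ≡ b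
T-injective {false} {false} _     = refl
T-injective {false} {true}  a⇔b = ⊥-elim (Equivalence.from a⇔b tt)
T-injective {true}  {false} a⇔b = ⊥-elim (Equivalence.to a⇔b tt)
T-injective {true}  {true}  _     = refl

T-≤ᵇ : ∀ {m n} → T (m ≤ᵇ n) ⇔ m ≤ n
T-≤ᵇ = mk⇔ (≤ᵇ⇒≤ _ _) ≤⇒≤ᵇ

T-⇒ᵇ : ∀ {a b} → T (a ⇒ᵇ b) ⇔ (T a → T b)
T-⇒ᵇ {false} = mk⇔ (λ _ ()) (λ _ → tt)
T-⇒ᵇ {true}  = mk⇔ (λ t _ → t) (λ f → f tt)

T-guarded : ∀ {a m x y} → T ((a ≤ᵇ m) ⇒ᵇ (x ≤ᵇ y)) ⇔ (a ≤ m → x ≤ y)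
T-guarded = mk⇔ (λ t a≤m → ≤ᵇ⇒≤ _ _ (Equivalence.to T-⇒ᵇ t (≤⇒≤ᵇ a≤m)))
                (λ f → Equivalence.from T-⇒ᵇ (λ ta → ≤⇒≤ᵇ (f (≤ᵇ⇒≤ _ _ ta))))

-- admissible n a b: a strict-alternating pistol on [n] with p(n) = a extends by p(n+1) = b.
link : ℕ → ℕ → ℕ → Bool
link zero                _ _ = true
link (suc zero)          a b = b ≤ᵇ a
link (suc (suc zero))    a b = a <ᵇ b
link (suc (suc (suc n))) a b = link (suc n) a b

admissible : ℕ → ℕ → ℕ → Bool
admissible n a b = (b ≤ᵇ ⌈ suc n /2⌉) ∧ link n a b

admissible-1+2i : ∀ i a b → admissible (suc (i + i)) a b ≡ (b ≤ᵇ suc i) ∧ (b ≤ᵇ a)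
admissible-1+2i i a b = cong₂ (λ c l → (b ≤ᵇ suc c) ∧ l) (sym (n≡⌈n+n/2⌉ i)) (link-1+2i i)
  where
  link-1+2i : ∀ i → link (suc (i + i)) a b ≡ (b ≤ᵇ a)
  link-1+2i zero    = refl
  link-1+2i (suc i) rewrite +-suc i i = link-1+2i i

admissible-2+2i : ∀ i a b → admissible (suc (suc (i + i))) a b ≡ (b ≤ᵇ suc (suc i)) ∧ (a <ᵇ b)
admissible-2+2i i a b = cong₂ (λ c l → (b ≤ᵇ suc (suc c)) ∧ l) (sym (n≡⌊n+n/2⌋ i)) (link-2+2i i)
  where
  link-2+2i : ∀ i → link (suc (suc (i + i))) a b ≡ (a <ᵇ b)
  link-2+2i zero    = refl
  link-2+2i (suc i) rewrite +-suc i i = link-2+2i i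

T-admissible-1+2i : ∀ {i a b} → T (admissible (suc (i + i)) a b) ⇔ (b ≤ suc i × b ≤ a)
T-admissible-1+2i {i} {a} {b} =
  subst (λ c → T c ⇔ (b ≤ suc i × b ≤ a)) (sym (admissible-1+2i i a b)) (⇔-trans T-∧ (T-≤ᵇ ×-⇔ T-≤ᵇ))

T-admissible-2+2i : ∀ {i a b} → T (admissible (suc (suc (i + i))) a b) ⇔ (b ≤ suc (suc i) × a < b)
T-admissible-2+2i {i} {a} {b} =
  subst (λ c → T c ⇔ (b ≤ suc (suc i) × a < b)) (sym (admissible-2+2i i a b)) (⇔-trans T-∧ (T-≤ᵇ ×-⇔ T-≤ᵇ))

admissible-bound : ∀ {n a b} → T (admissible n a b) → b ≤ ⌈ suc n /2⌉
admissible-bound t = ≤ᵇ⇒≤ _ _ (proj₁ (Equivalence.to T-∧ t))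

-- The four conditions of isStrictAlt for the index i + 1, on the positions 2i+1, 2i+2, 2i+3.
StrictAltAt : ℕ → List ℕ → ℕ → Set
StrictAltAt m p i =
    (suc o ≤ m → at p (suc o) ≤ suc i)
  × (o ≤ m → at p o ≤ suc i)
  × (suc o ≤ m → at p (suc o) ≤ at p o)
  × (suc (suc o) ≤ m → at p (suc o) < at p (suc (suc o)))
  where o = suc (i + i)

-- Stated for every N equal to 2i+2, as isStrictAlt produces it in the form suc i + suc i.
T-conditions : ∀ {m p i} N → N ≡ suc (suc (i + i)) →
  T (((N ≤ᵇ m) ⇒ᵇ (at p N ≤ᵇ suc i)) ∧ ((N ∸ 1 ≤ᵇ m) ⇒ᵇ (at p (N ∸ 1) ≤ᵇ suc i)) ∧
     ((N ≤ᵇ m) ⇒ᵇ (at p N ≤ᵇ at p (N ∸ 1))) ∧ ((suc N ≤ᵇ m) ⇒ᵇ (at p N <ᵇ at p (suc N))))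
  ⇔ StrictAltAt m p i
T-conditions _ refl =
  ⇔-trans T-∧ (T-guarded ×-⇔ ⇔-trans T-∧ (T-guarded ×-⇔ ⇔-trans T-∧ (T-guarded ×-⇔ T-guarded)))

StrictAlt : ℕ → List ℕ → Set
StrictAlt m p = ∀ i → i < m → StrictAltAt m p i

T-isStrictAlt⇔StrictAlt : ∀ m p → T (isStrictAlt m p) ⇔ StrictAlt m p
T-isStrictAlt⇔StrictAlt m p = mk⇔
  (λ t i i<m → Equivalence.to (conditions i) (applyUpTo⁻ _ m (all⁺ _ _ t) i<m))
  (λ sa → all⁻ _ (applyUpTo⁺₁ _ m (λ {i} i<m → Equivalence.from (conditions i) (sa i i<m))))
  where
  conditions : ∀ i → _
  conditions i = T-conditions {m} {p} {i} (suc i + suc i) (cong suc (+-suc i i))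

Admissible : ℕ → List ℕ → Set
Admissible m p = ∀ k → k < m → T (admissible k (at p k) (at p (suc k)))

StrictAlt⇒Admissible : ∀ {m p} → StrictAlt m p → Admissible m p
StrictAlt⇒Admissible {m} {p} sa k k<m with parity k
... | zero   = Equivalence.from T-∧ (≤⇒≤ᵇ (proj₁ (proj₂ (sa 0 k<m)) k<m) , tt)
... | odd i  = let even-bound , _ , descent , _ = sa i (≤-trans (s≤s (m≤m+n i i)) (<⇒≤ k<m))
               in Equivalence.from (T-admissible-1+2i {i}) (even-bound k<m , descent k<m)
... | even i = Equivalence.from (T-admissible-2+2i {i}) (bound , ascent k<m)
  where
  -- the ascent p(2i+2) < p(2i+3) belongs to the index i + 1, the bound on p(2i+3) to i + 2
  ascent = proj₂ (proj₂ (proj₂ (sa i (≤-trans (s≤s (m≤m+n i i)) (<⇒≤ (<⇒≤ k<m))))))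
  bound : at p (suc (suc (suc (i + i)))) ≤ suc (suc i)
  bound = subst (λ o → o ≤ m → at p o ≤ suc (suc i)) (cong (suc ∘ suc) (+-suc i i))
                (proj₁ (proj₂ (sa (suc i) (≤-trans (s≤s (s≤s (m≤m+n i i))) (<⇒≤ k<m))))) k<m

Admissible⇒StrictAlt : ∀ {m p} → Admissible m p → StrictAlt m p
Admissible⇒StrictAlt {m} {p} adm i _ =
    (λ le → proj₁ (descent le))
  , (λ le → subst (λ c → at p (suc (i + i)) ≤ suc c) (sym (n≡⌊n+n/2⌋ i))
                  (admissible-bound (adm (i + i) le)))
  , (λ le → proj₂ (descent le))
  , (λ le → proj₂ (Equivalence.to (T-admissible-2+2i {i}) (adm (suc (suc (i + i))) le)))
  where
  descent : suc (suc (i + i)) ≤ m → _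
  descent le = Equivalence.to (T-admissible-1+2i {i}) (adm (suc (i + i)) le)

T-isStrictAlt⇔Admissible : ∀ m p → T (isStrictAlt m p) ⇔ Admissible m p
T-isStrictAlt⇔Admissible m p =
  ⇔-trans (T-isStrictAlt⇔StrictAlt m p) (mk⇔ (StrictAlt⇒Admissible {m} {p}) (Admissible⇒StrictAlt {m} {p}))

Admissible-∷ʳ : ∀ xs v → let n = length xs in
  Admissible (suc n) (xs ∷ʳ v) ⇔ (Admissible n xs × T (admissible n (at xs n) v))
Admissible-∷ʳ xs v = mk⇔
  (λ adm → (λ k k<n → subst T (earlier k<n) (adm k (m<n⇒m<1+n k<n)))
         , subst T last (adm (length xs) ≤-refl))
  (λ (adm , t) k k<1+n → [ (λ k<n → subst T (sym (earlier k<n)) (adm k k<n))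
                         , (λ { refl → subst T (sym last) t }) ]′ (m<1+n⇒m<n∨m≡n k<1+n))
  where
  earlier : ∀ {k} → k < length xs →
    admissible k (at (xs ∷ʳ v) k) (at (xs ∷ʳ v) (suc k)) ≡ admissible k (at xs k) (at xs (suc k))
  earlier k<n = cong₂ (admissible _) (at-∷ʳ xs v (<⇒≤ k<n)) (at-∷ʳ xs v k<n)
  last : admissible (length xs) (at (xs ∷ʳ v) (length xs)) (at (xs ∷ʳ v) (suc (length xs)))
       ≡ admissible (length xs) (at xs (length xs)) v
  last = cong₂ (admissible _) (at-∷ʳ xs v ≤-refl) (at-∷ʳ-last xs v)

isStrictAlt-∷ʳ : ∀ {n} xs v → length xs ≡ n →
  isStrictAlt (suc n) (xs ∷ʳ v) ≡ isStrictAlt n xs ∧ admissible n (at xs n) v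
isStrictAlt-∷ʳ xs v refl = T-injective
  (⇔-trans (T-isStrictAlt⇔Admissible _ (xs ∷ʳ v))
  (⇔-trans (Admissible-∷ʳ xs v)
  (⇔-trans (⇔-sym (T-isStrictAlt⇔Admissible _ xs) ×-⇔ ⇔-id _) (⇔-sym T-∧))))

isStrictAlt-bound : ∀ n p → T (isStrictAlt (suc n) p) → at p (suc n) ≤ ⌈ suc n /2⌉
isStrictAlt-bound n p t = admissible-bound (Equivalence.to (T-isStrictAlt⇔Admissible _ p) t n ≤-refl)

-- The generating functions and their recursion

-- The right-hand side with the values of the pistols drawn from [m]: sapSum i j is sapPoly i i j,
-- and fixing m lets the recursion shorten pistols without changing the candidate values.
sapPoly : ℕ → ℕ → ℕ → Poly
sapPoly m n j k = ∑[ p ∈ maps n m ] when (isSAP n j p) (mono (ch p + 1 ∸ j) k)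

ΣP-map-filter : ∀ (b : A → Bool) (g : A → Poly) xs k →
  ΣP (map g (filter (λ x → T? (b x)) xs)) k ≡ ∑[ x ∈ xs ] when (b x) (g x k)
ΣP-map-filter b g []       k = refl
ΣP-map-filter b g (x ∷ xs) k with b x
... | true  = cong (g x k +_) (ΣP-map-filter b g xs k)
... | false = ΣP-map-filter b g xs k

sapSum≡sapPoly : ∀ i j k → sapSum i j k ≡ sapPoly i i j k
sapSum≡sapPoly i j k = ΣP-map-filter (isSAP i j) (λ p → mono (ch p + 1 ∸ j)) (maps i i) k

T-isSAP : ∀ {n j} p → T (isSAP n j p) → T (isStrictAlt n p) × at p n ≡ j
T-isSAP {n} {j} p t with sa , last≡j ← Equivalence.to (T-∧ {isStrictAlt n p}) t = sa , ≡ᵇ⇒≡ (at p n) j last≡j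

sapPoly-vanishes : ∀ m n {j} → ⌈ suc n /2⌉ < j → ∀ k → sapPoly m (suc n) j k ≡ 0
sapPoly-vanishes m n {j} bound<j k =
  ∑-zero (All.universal (λ p → when-zero (isSAP (suc n) j p) {mono (ch p + 1 ∸ j) k} (⊥-elim ∘ beyond p))
                        (maps (suc n) m))
  where
  beyond : ∀ p → T (isSAP (suc n) j p) → ⊥
  beyond p t with sa , last≡j ← T-isSAP p t =
    <⇒≱ bound<j (subst (_≤ ⌈ suc n /2⌉) last≡j (isStrictAlt-bound n p sa))

isSAP-∷ʳ : ∀ {n} j xs v → length xs ≡ n →
  isSAP (suc n) j (xs ∷ʳ v) ≡ (isStrictAlt n xs ∧ admissible n (at xs n) v) ∧ (v ≡ᵇ j)
isSAP-∷ʳ j xs v refl = cong₂ _∧_ (isStrictAlt-∷ʳ xs v refl) (cong (_≡ᵇ j) (at-∷ʳ-last xs v))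

m+1∸n≡m∸[n∸1] : ∀ m {n} → 1 ≤ n → m + 1 ∸ n ≡ m ∸ (n ∸ 1)
m+1∸n≡m∸[n∸1] m {suc n} _ = cong (_∸ suc n) (+-comm m 1)

ch[xs∷ʳj]+1∸j≡ch[xs] : ∀ xs {j} → 1 ≤ j → ch (xs ∷ʳ j) + 1 ∸ j ≡ ch xs
ch[xs∷ʳj]+1∸j≡ch[xs] xs {j} 1≤j = begin
  ch (xs ∷ʳ j) + 1 ∸ j      ≡⟨ m+1∸n≡m∸[n∸1] (ch (xs ∷ʳ j)) 1≤j ⟩
  ch (xs ∷ʳ j) ∸ (j ∸ 1)    ≡⟨ cong (_∸ (j ∸ 1)) (ch-∷ʳ xs j) ⟩
  ch xs + (j ∸ 1) ∸ (j ∸ 1) ≡⟨ m+n∸n≡m (ch xs) (j ∸ 1) ⟩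
  ch xs                     ∎
  where open ≡-Reasoning

sapPoly-∷ʳ : ∀ m n {j} → 1 ≤ j → j ≤ m → ∀ k → sapPoly m (suc n) j k ≡
  ∑[ xs ∈ maps n m ] when (isStrictAlt n xs ∧ admissible n (at xs n) j) (mono (ch xs) k)
sapPoly-∷ʳ m n {j} 1≤j j≤m k =
  trans (∑-maps-∷ʳ n m _) (∑-cong (All-maps n m (λ {xs} len _ → last-value {xs} len)))
  where
  open ≡-Reasoning
  last-value : ∀ {xs} → length xs ≡ n →
    ∑[ v ∈ range m ] when (isSAP (suc n) j (xs ∷ʳ v)) (mono (ch (xs ∷ʳ v) + 1 ∸ j) k)
    ≡ when (isStrictAlt n xs ∧ admissible n (at xs n) j) (mono (ch xs) k)
  last-value {xs} len = begin
    ∑[ v ∈ range m ] when (isSAP (suc n) j (xs ∷ʳ v)) (mono (ch (xs ∷ʳ v) + 1 ∸ j) k)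
      ≡⟨ ∑-cong-∀ (range m) (λ v → trans (cong (λ b → when b (term v)) (isSAP-∷ʳ j xs v len))
                                        (when-∧ (extends v) (v ≡ᵇ j) (term v))) ⟩
    ∑[ v ∈ range m ] when (v ≡ᵇ j) (F v)
      ≡⟨ ∑-select m F 1≤j j≤m ⟩
    F j
      ≡⟨ cong (λ c → when (extends j) (mono c k)) (ch[xs∷ʳj]+1∸j≡ch[xs] xs 1≤j) ⟩
    when (isStrictAlt n xs ∧ admissible n (at xs n) j) (mono (ch xs) k)
      ∎
    where
    extends : ℕ → Bool
    extends v = isStrictAlt n xs ∧ admissible n (at xs n) v
    term : ℕ → ℕ
    term v = mono (ch (xs ∷ʳ v) + 1 ∸ j) k
    F : ℕ → ℕ
    F v = when (extends v) (term v)

∑-partition : ∀ m (s : A → ℕ) (F : ℕ → A → ℕ) {xs} → All (InRange m ∘ s) xs →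
  ∑[ x ∈ xs ] F (s x) x ≡ ∑[ v ∈ range m ] ∑[ x ∈ xs ] when (s x ≡ᵇ v) (F v x)
∑-partition m s F {xs} in-range =
  trans (∑-cong (All.map by-value in-range)) (∑-swap xs (range m) (λ x v → when (s x ≡ᵇ v) (F v x)))
  where
  by-value : ∀ {x} → InRange m (s x) → F (s x) x ≡ ∑[ v ∈ range m ] when (s x ≡ᵇ v) (F v x)
  by-value {x} (1≤s , s≤m) = sym (trans
    (∑-cong-∀ (range m) (λ v → cong (λ b → when b (F v x)) (≡ᵇ-sym (s x) v)))
    (∑-select m (λ v → F v x) 1≤s s≤m))

when-reorder : ∀ x s a y → when x (when (s ∧ a) y) ≡ when a (when (s ∧ x) y)
when-reorder false false false y = refl
when-reorder false false true  y = refl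
when-reorder false true  false y = refl
when-reorder false true  true  y = refl
when-reorder true  false false y = refl
when-reorder true  false true  y = refl
when-reorder true  true  false y = refl
when-reorder true  true  true  y = refl

when-q^·-mono : ∀ b {e c} → (T b → e ≤ c) → ∀ k →
  when b (mono c k) ≡ (q^ e · (λ k → when b (mono (c ∸ e) k))) k
when-q^·-mono false {e} _   k = sym (q^·-zero e (λ _ → refl) k)
when-q^·-mono true      e≤c k = q^·-mono (e≤c tt) k

sapPoly-by-last : ∀ m n {j} → 1 ≤ n → ∀ k →
  ∑[ xs ∈ maps n m ] when (isStrictAlt n xs ∧ admissible n (at xs n) j) (mono (ch xs) k)
  ≡ ∑[ j′ ∈ range m ] when (admissible n j′ j) ((q^ (j′ ∸ 1) · sapPoly m n j′) k)
sapPoly-by-last m n {j} 1≤n k = begin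
  ∑[ xs ∈ maps n m ] when (isStrictAlt n xs ∧ admissible n (at xs n) j) (mono (ch xs) k)
    ≡⟨ ∑-partition m (λ xs → at xs n) (λ a xs → when (isStrictAlt n xs ∧ admissible n a j) (mono (ch xs) k))
                   (All-maps n m (λ len vs → at-All vs 1≤n (≤-reflexive (sym len)))) ⟩
  ∑[ j′ ∈ range m ] ∑[ xs ∈ maps n m ]
    when (at xs n ≡ᵇ j′) (when (isStrictAlt n xs ∧ admissible n j′ j) (mono (ch xs) k))
    ≡⟨ ∑-cong (All-range m (λ 1≤j′ _ → ending-with 1≤j′)) ⟩
  ∑[ j′ ∈ range m ] when (admissible n j′ j) ((q^ (j′ ∸ 1) · sapPoly m n j′) k)
    ∎
  where
  open ≡-Reasoning
  ending-with : ∀ {j′} → 1 ≤ j′ →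
    ∑[ xs ∈ maps n m ] when (at xs n ≡ᵇ j′) (when (isStrictAlt n xs ∧ admissible n j′ j) (mono (ch xs) k))
    ≡ when (admissible n j′ j) ((q^ (j′ ∸ 1) · sapPoly m n j′) k)
  ending-with {j′} 1≤j′ = begin
    ∑[ xs ∈ maps n m ] when (at xs n ≡ᵇ j′) (when (isStrictAlt n xs ∧ admissible n j′ j) (mono (ch xs) k))
      ≡⟨ ∑-cong-∀ (maps n m) (λ xs →
           when-reorder (at xs n ≡ᵇ j′) (isStrictAlt n xs) (admissible n j′ j) (mono (ch xs) k)) ⟩
    ∑[ xs ∈ maps n m ] when (admissible n j′ j) (when (isSAP n j′ xs) (mono (ch xs) k))
      ≡⟨ sym (∑-when _ (maps n m) (λ xs → when (isSAP n j′ xs) (mono (ch xs) k))) ⟩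
    when (admissible n j′ j) (∑[ xs ∈ maps n m ] when (isSAP n j′ xs) (mono (ch xs) k))
      ≡⟨ cong (when (admissible n j′ j)) (∑-cong-∀ (maps n m) shift) ⟩
    when (admissible n j′ j) (∑[ xs ∈ maps n m ] (q^ (j′ ∸ 1) · weight xs) k)
      ≡⟨ cong (when (admissible n j′ j)) (sym (q^·-∑ (j′ ∸ 1) (maps n m) weight k)) ⟩
    when (admissible n j′ j) ((q^ (j′ ∸ 1) · sapPoly m n j′) k)
      ∎
    where
    weight : List ℕ → Poly
    weight xs k = when (isSAP n j′ xs) (mono (ch xs + 1 ∸ j′) k)
    shift : ∀ xs → when (isSAP n j′ xs) (mono (ch xs) k) ≡ (q^ (j′ ∸ 1) · weight xs) k
    shift xs = trans (when-q^·-mono (isSAP n j′ xs) {j′ ∸ 1} {ch xs} j′∸1≤ch k)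
                     (q^·-cong (j′ ∸ 1) (λ k → cong (λ c → when (isSAP n j′ xs) (mono c k)) exponent) k)
      where
      j′∸1≤ch : T (isSAP n j′ xs) → j′ ∸ 1 ≤ ch xs
      j′∸1≤ch t = subst (λ a → a ∸ 1 ≤ ch xs) (proj₂ (T-isSAP xs t)) (at∸1≤ch xs n)
      exponent : ch xs ∸ (j′ ∸ 1) ≡ ch xs + 1 ∸ j′
      exponent = sym (m+1∸n≡m∸[n∸1] (ch xs) 1≤j′)

sapPoly-rec : ∀ m n {j} → 1 ≤ n → 1 ≤ j → j ≤ m → ∀ k →
  sapPoly m (suc n) j k ≡ ∑[ j′ ∈ range m ] when (admissible n j′ j) ((q^ (j′ ∸ 1) · sapPoly m n j′) k)
sapPoly-rec m n 1≤n 1≤j j≤m k = trans (sapPoly-∷ʳ m n 1≤j j≤m k) (sapPoly-by-last m n 1≤n k)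

-- The rows of h

oddAux-∑ : ∀ m (E : ℕ → Poly) {j} → 1 ≤ j → j ≤ suc m → ∀ k →
  oddAux E j k ≡ ∑[ v ∈ range m ] when (v <ᵇ j) ((q^ (v ∸ 1) · E v) k)
oddAux-∑ m E {suc zero}    _ _              k = sym (∑-zero (All-range m (λ { (s≤s _) _ → refl })))
oddAux-∑ m E {suc (suc j)} _ (s≤s 1+j≤m) k = begin
  oddAux E (suc j) k + term (suc j)
    ≡⟨ cong₂ _+_ (oddAux-∑ m E (s≤s z≤n) (m≤n⇒m≤1+n 1+j≤m) k) (sym (∑-select m term (s≤s z≤n) 1+j≤m)) ⟩
  ∑[ v ∈ range m ] when (v <ᵇ suc j) (term v) + ∑[ v ∈ range m ] when (v ≡ᵇ suc j) (term v)
    ≡⟨ sym (∑-+ (range m) _ _) ⟩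
  ∑[ v ∈ range m ] (when (v <ᵇ suc j) (term v) + when (v ≡ᵇ suc j) (term v))
    ≡⟨ ∑-cong-∀ (range m) (λ v → sym (when-<ᵇ-suc v (suc j) (term v))) ⟩
  ∑[ v ∈ range m ] when (v <ᵇ suc (suc j)) (term v)
    ∎
  where
  open ≡-Reasoning
  term : ℕ → ℕ
  term v = (q^ (v ∸ 1) · E v) k

evenAux-∑ : ∀ m (O : ℕ → Poly) {j} d → (∀ {v} → j + d ≤ v → ∀ k → O v k ≡ 0) →
  1 ≤ j → j + d ≤ suc m → ∀ k →
  evenAux O j d k ≡ ∑[ v ∈ range m ] when (j ≤ᵇ v) ((q^ (v ∸ 1) · O v) k)
evenAux-∑ m O {j} zero O≡0 _ _ k = sym (∑-zero (All.universal vanishes (range m)))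
  where
  vanishes : ∀ v → when (j ≤ᵇ v) ((q^ (v ∸ 1) · O v) k) ≡ 0
  vanishes v = when-zero (j ≤ᵇ v) (λ j≤v →
    q^·-zero (v ∸ 1) (O≡0 (subst (_≤ v) (sym (+-identityʳ j)) (≤ᵇ⇒≤ j v j≤v))) k)
evenAux-∑ m O {j} (suc d) O≡0 1≤j j+d<1+m k = begin
  evenAux O (suc j) d k + term j
    ≡⟨ cong₂ _+_ (evenAux-∑ m O d (λ {v} le → O≡0 (subst (_≤ v) (sym (+-suc j d)) le)) (s≤s z≤n) 1+j+d≤1+m k)
                 (sym (∑-select m term 1≤j (≤-trans (m≤m+n j d) (≤-pred 1+j+d≤1+m)))) ⟩
  ∑[ v ∈ range m ] when (suc j ≤ᵇ v) (term v) + ∑[ v ∈ range m ] when (v ≡ᵇ j) (term v)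
    ≡⟨ sym (∑-+ (range m) _ _) ⟩
  ∑[ v ∈ range m ] (when (suc j ≤ᵇ v) (term v) + when (v ≡ᵇ j) (term v))
    ≡⟨ ∑-cong-∀ (range m) (λ v → sym (when-≤ᵇ-suc j v (term v))) ⟩
  ∑[ v ∈ range m ] when (j ≤ᵇ v) (term v)
    ∎
  where
  open ≡-Reasoning
  term : ℕ → ℕ
  term v = (q^ (v ∸ 1) · O v) k
  1+j+d≤1+m : suc j + d ≤ suc m
  1+j+d≤1+m = subst (_≤ suc m) (+-suc j d) j+d<1+m

≤ᵇ-true : ∀ {m n} → m ≤ n → (m ≤ᵇ n) ≡ true
≤ᵇ-true m≤n = Equivalence.to T-≡ (≤⇒≤ᵇ m≤n)

≤ᵇ-false : ∀ {m n} → n < m → (m ≤ᵇ n) ≡ false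
≤ᵇ-false {m} {n} n<m with m ≤ᵇ n in eq
... | true  = ⊥-elim (<⇒≱ n<m (≤ᵇ⇒≤ m n (subst T (sym eq) tt)))
... | false = refl

inRange-true : ∀ {b j} → 1 ≤ j → j ≤ b → inRange b j ≡ true
inRange-true {j = suc j} _ = ≤ᵇ-true

inRange-false : ∀ {b j} → b < j → inRange b j ≡ false
inRange-false {j = suc j} = ≤ᵇ-false

Agrees : ℕ → ℕ → (ℕ → Poly) → Set
Agrees m n H = ∀ j → 1 ≤ j → ∀ k → H j k ≡ sapPoly m n j k

agrees-first : ∀ {m} → 1 ≤ m → Agrees m 1 (Hodd 0)
agrees-first {m} 1≤m (suc zero) _ k =
  sym (trans (sapPoly-∷ʳ m 0 (s≤s z≤n) 1≤m k) (+-identityʳ (mono 0 k)))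
agrees-first {m} 1≤m (suc (suc j)) _ k = sym (sapPoly-vanishes m 0 (s≤s (s≤s z≤n)) k)

agrees-odd-step : ∀ {m} r → suc (suc (suc (r + r))) ≤ m →
  Agrees m (suc (suc (r + r))) (Heven (suc r)) → Agrees m (suc (suc (suc (r + r)))) (Hodd (suc r))
agrees-odd-step {m} r 3+2r≤m IH j 1≤j k with j ≤? suc (suc r)
... | no j≰2+r = begin
  Hodd (suc r) j k
    ≡⟨ cong (λ b → (if b then oddAux (Heven (suc r)) j else 0P) k) (inRange-false (≰⇒> j≰2+r)) ⟩
  0
    ≡⟨ sym (sapPoly-vanishes m (suc (suc (r + r))) (subst (_< j) (cong (suc ∘ suc) (n≡⌊n+n/2⌋ r)) (≰⇒> j≰2+r)) k) ⟩
  sapPoly m (suc (suc (suc (r + r)))) j k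
    ∎
  where open ≡-Reasoning
... | yes j≤2+r = begin
  Hodd (suc r) j k
    ≡⟨ cong (λ b → (if b then oddAux (Heven (suc r)) j else 0P) k) (inRange-true 1≤j j≤2+r) ⟩
  oddAux (Heven (suc r)) j k
    ≡⟨ oddAux-∑ m (Heven (suc r)) 1≤j (m≤n⇒m≤1+n j≤m) k ⟩
  ∑[ v ∈ range m ] when (v <ᵇ j) ((q^ (v ∸ 1) · Heven (suc r) v) k)
    ≡⟨ ∑-cong (All-range m (λ {v} 1≤v _ → cong₂ when (sym (ascent v)) (q^·-cong (v ∸ 1) (IH v 1≤v) k))) ⟩
  ∑[ v ∈ range m ] when (admissible (suc (suc (r + r))) v j) ((q^ (v ∸ 1) · sapPoly m (suc (suc (r + r))) v) k)
    ≡⟨ sym (sapPoly-rec m (suc (suc (r + r))) (s≤s z≤n) 1≤j j≤m k) ⟩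
  sapPoly m (suc (suc (suc (r + r)))) j k
    ∎
  where
  open ≡-Reasoning
  j≤m : j ≤ m
  j≤m = ≤-trans j≤2+r (≤-trans (s≤s (s≤s (m≤m+n r r))) (≤-trans (n≤1+n _) 3+2r≤m))
  ascent : ∀ v → admissible (suc (suc (r + r))) v j ≡ (v <ᵇ j)
  ascent v = trans (admissible-2+2i r v j) (cong (_∧ (v <ᵇ j)) (≤ᵇ-true j≤2+r))

agrees-even-step : ∀ {m} r → suc (suc (r + r)) ≤ m →
  Agrees m (suc (r + r)) (Hodd r) → Agrees m (suc (suc (r + r))) (Heven (suc r))
agrees-even-step {m} r 2+2r≤m IH j 1≤j k with j ≤? suc r
... | no j≰1+r = begin
  Heven (suc r) j k
    ≡⟨ cong (λ b → (if b then evenAux (Hodd r) j (suc (suc r) ∸ j) else 0P) k) (inRange-false (≰⇒> j≰1+r)) ⟩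
  0
    ≡⟨ sym (sapPoly-vanishes m (suc (r + r)) (subst (_< j) (cong suc (n≡⌈n+n/2⌉ r)) (≰⇒> j≰1+r)) k) ⟩
  sapPoly m (suc (suc (r + r))) j k
    ∎
  where open ≡-Reasoning
... | yes j≤1+r = begin
  Heven (suc r) j k
    ≡⟨ cong (λ b → (if b then evenAux (Hodd r) j (suc (suc r) ∸ j) else 0P) k) (inRange-true 1≤j j≤1+r) ⟩
  evenAux (Hodd r) j (suc (suc r) ∸ j) k
    ≡⟨ evenAux-∑ m (Hodd r) (suc (suc r) ∸ j) vanishes 1≤j (subst (_≤ suc m) (sym j+d≡2+r) (s≤s 1+r≤m)) k ⟩
  ∑[ v ∈ range m ] when (j ≤ᵇ v) ((q^ (v ∸ 1) · Hodd r v) k)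
    ≡⟨ ∑-cong (All-range m (λ {v} 1≤v _ → cong₂ when (sym (descent v)) (q^·-cong (v ∸ 1) (IH v 1≤v) k))) ⟩
  ∑[ v ∈ range m ] when (admissible (suc (r + r)) v j) ((q^ (v ∸ 1) · sapPoly m (suc (r + r)) v) k)
    ≡⟨ sym (sapPoly-rec m (suc (r + r)) (s≤s z≤n) 1≤j (≤-trans j≤1+r 1+r≤m) k) ⟩
  sapPoly m (suc (suc (r + r))) j k
    ∎
  where
  open ≡-Reasoning
  1+r≤m : suc r ≤ m
  1+r≤m = ≤-trans (s≤s (m≤m+n r r)) (≤-trans (n≤1+n _) 2+2r≤m)
  j+d≡2+r : j + (suc (suc r) ∸ j) ≡ suc (suc r)
  j+d≡2+r = m+[n∸m]≡n (m≤n⇒m≤1+n j≤1+r)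
  vanishes : ∀ {v} → j + (suc (suc r) ∸ j) ≤ v → ∀ k → Hodd r v k ≡ 0
  vanishes {v} le k = trans (IH v (≤-trans (s≤s z≤n) 2+r≤v) k)
    (sapPoly-vanishes m (r + r) (subst (_< v) (cong suc (n≡⌊n+n/2⌋ r)) 2+r≤v) k)
    where
    2+r≤v : suc (suc r) ≤ v
    2+r≤v = subst (_≤ v) j+d≡2+r le
  descent : ∀ v → admissible (suc (r + r)) v j ≡ (j ≤ᵇ v)
  descent v = trans (admissible-1+2i r v j) (cong (_∧ (j ≤ᵇ v)) (≤ᵇ-true j≤1+r))

agrees-odd : ∀ {m} r → suc (r + r) ≤ m → Agrees m (suc (r + r)) (Hodd r)
agrees-odd zero    1≤m     = agrees-first 1≤m
agrees-odd {m} (suc r) 3+2r≤m =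
  subst (λ n → Agrees m n (Hodd (suc r))) (sym 2+2r+1≡)
        (agrees-odd-step r le (agrees-even-step r (<⇒≤ le) (agrees-odd r (<⇒≤ (<⇒≤ le)))))
  where
  2+2r+1≡ : suc (suc r + suc r) ≡ suc (suc (suc (r + r)))
  2+2r+1≡ = cong (suc ∘ suc) (+-suc r r)
  le : suc (suc (suc (r + r))) ≤ m
  le = subst (_≤ m) 2+2r+1≡ 3+2r≤m

agrees-even : ∀ {m} r → suc (suc (r + r)) ≤ m → Agrees m (suc (suc (r + r))) (Heven (suc r))
agrees-even r le = agrees-even-step r le (agrees-odd r (<⇒≤ le))

r+r≡r*2 : ∀ r → r + r ≡ r * 2
r+r≡r*2 r = trans (cong (r +_) (sym (+-identityʳ r))) (*-comm 2 r)

h-odd : ∀ r j → h (suc (r + r)) j ≡ Hodd r j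
h-odd r j = cong₂ (λ a b → if a ≡ᵇ 0 then Heven b j else Hodd b j) %2≡1 /2≡r
  where
  %2≡1 : suc (r + r) % 2 ≡ 1
  %2≡1 = trans (cong (λ x → suc x % 2) (r+r≡r*2 r)) ([m+kn]%n≡m%n 1 r 2)
  /2≡r : suc (r + r) / 2 ≡ r
  /2≡r = trans (cong (λ x → suc x / 2) (r+r≡r*2 r))
               (trans (+-distrib-/-∣ʳ 1 {r * 2} {2} (divides r refl)) (m*n/n≡m r 2))

h-even : ∀ r j → h (suc (suc (r + r))) j ≡ Heven (suc r) j
h-even r j = cong₂ (λ a b → if a ≡ᵇ 0 then Heven b j else Hodd b j) %2≡0 /2≡1+r
  where
  %2≡0 : suc (suc (r + r)) % 2 ≡ 0
  %2≡0 = trans (cong (λ x → suc (suc x) % 2) (r+r≡r*2 r)) ([m+kn]%n≡m%n 2 r 2)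
  /2≡1+r : suc (suc (r + r)) / 2 ≡ suc r
  /2≡1+r = trans (cong (λ x → suc (suc x) / 2) (r+r≡r*2 r))
                 (trans (+-distrib-/-∣ʳ 2 {r * 2} {2} (divides r refl)) (cong suc (m*n/n≡m r 2)))

proposition2 : (i j : ℕ) → 1 ≤ i → 1 ≤ j → j ≤ ⌈ i /2⌉ →
    (k : ℕ) → h i j k ≡ sapSum i j k
proposition2 i j 1≤i 1≤j _ k with parity i
proposition2 _ j () _ _ k | zero
... | odd r  = trans (cong-app (h-odd r j) k)
               (trans (agrees-odd r ≤-refl j 1≤j k) (sym (sapSum≡sapPoly (suc (r + r)) j k)))
... | even r = trans (cong-app (h-even r j) k)
               (trans (agrees-even r ≤-refl j 1≤j k) (sym (sapSum≡sapPoly (suc (suc (r + r))) j k)))
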